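{- Let $\Gamma$ be a finite group of odd order, $S_0\subseteq\Gamma$ a set of $m$ generators, and $S=\{g^{\pm1}:g\in S_0\}$ the associated symmetric generating set, assumed to have $2m$ elements. Let $G=\mathcal{C}(\Gamma,S)$ and let $\sigma$ be a partition of $S$. Then the fractured graph $\mathrm{Frac}(G,\sigma)$ is bipartite if and only if the graph $B(\sigma)$ is bipartite.
   Context: The Cayley graph $\mathcal{C}(\Gamma,S)$ has vertex set $\Gamma$ and edges $\{x,xs\}$, $x\in\Gamma$, $s\in S$; the edges incident to $v$ are identified with $S$ via $\{v,vg\}\leftrightarrow g$. A partition $\sigma$ of $S$ thereby defines a fracture of $G$ by taking at every vertex $v$ the partition of the incident edges corresponding to $\sigma$. For a fracture $\rho=(\rho_v)_v$ (each $\rho_v$ a partition of the edges at $v$), the fractured graph $\mathrm{Frac}(G,\rho)$ has a vertex $v^B$ for each $v$ and block $B$ of $\rho_v$, and for each edge $e=\{u,v\}$ an edge joining $u^B$ and $v^{B'}$, where $B\ni e$ is a block of $\rho_u$ and $B'\ni e$ a block of $\rho_v$; $\mathrm{Frac}(G,\sigma)$ denotes this graph for the fracture induced by $\sigma$. The graph $B(\sigma)$ (possibly with loops and multiple edges) has a vertex $w^B$ for each block $B$ of $\sigma$ and, for each $g\in S_0$, one edge $\{w^B,w^{B'}\}$ where $g\in B$ and $g^{ -1}\in B'$. A graph (with loops/multiedges allowed) is bipartite if its vertices can be partitioned into two sets such that every edge has one endpoint in each set. -}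

module Defs where

open import Data.Nat using (ℕ; _+_; _*_)
open import Data.Fin using (Fin)
open import Data.Bool using (Bool; true; false; not)
open import Data.Product using (Σ; ∃; _×_; _,_; proj₁; proj₂)
open import Data.List using (List; foldr)
open import Relation.Binary.PropositionalEquality using (_≡_; _≢_)

Odd : ℕ → Set
Odd n = ∃ λ j → n ≡ 1 + 2 * j

-- A multigraph (loops and multiple edges allowed): every edge has two
-- endpoints (listed in an arbitrary order; edges are unoriented).
record Multigraph : Set₁ where
  field
    Vertex : Set
    Edge   : Set
    ends   : Edge → Vertex × Vertex

Bipartite : Multigraph → Set
Bipartite G =
  let open Multigraph G in
  Σ (Vertex → Bool) λ side → ∀ (e : Edge) → side (proj₁ (ends e)) ≢ side (proj₂ (ends e))

-- Index set of S = {g^{±1} : g ∈ S₀} where S₀ = {gen i : i : Fin m}: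
-- (i , true) stands for gen i and (i , false) for (gen i)⁻¹.
SIdx : ℕ → Set
SIdx m = Fin m × Bool

invIdx : ∀ {m} → SIdx m → SIdx m
invIdx (i , b) = (i , not b)

-- A partition σ of S with k blocks, encoded by the block label of each
-- element of S; every one of the k labels must be used (blocks nonempty).
IsPartitionLabelling : ∀ {m k} → (SIdx m → Fin k) → Set
IsPartitionLabelling {m} {k} σ = ∀ (b : Fin k) → ∃ λ (s : SIdx m) → σ s ≡ b

BGraph : ∀ {m k} → (SIdx m → Fin k) → Multigraph
BGraph {m} {k} σ = record
  { Vertex = Fin k
  ; Edge   = Fin m
  ; ends   = λ i → (σ (i , true) , σ (i , false))
  }

module _ {A : Set} (_∙_ : A → A → A) (ε : A) (_⁻¹ : A → A) where

  sElt : ∀ {m} → (Fin m → A) → SIdx m → A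
  sElt gen (i , true)  = gen i
  sElt gen (i , false) = (gen i) ⁻¹

  Generates : ∀ {m} → (Fin m → A) → Set
  Generates {m} gen =
    ∀ (x : A) → ∃ λ (w : List (SIdx m)) → x ≡ foldr (λ s acc → sElt gen s ∙ acc) ε w

  -- The Cayley graph C(Γ,S): vertices Γ, edges {x, x s} (indexed by (x , s);
  -- each geometric edge {x,xs} = {xs, (xs)s⁻¹} is listed twice, which is
  -- irrelevant for bipartiteness).
  CayleyGraph : ∀ {m} → (Fin m → A) → Multigraph
  CayleyGraph {m} gen = record
    { Vertex = A
    ; Edge   = A × SIdx m
    ; ends   = λ { (x , s) → (x , x ∙ sElt gen s) }
    }

  -- Frac(G,σ): vertices v^B (v ∈ Γ, B a block of σ).  The edge {x, xs} is
  -- identified with s at x and with s⁻¹ at xs (since {xs, xs·s⁻¹} = {x,xs}),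
  -- so it joins x^{σ(s)} and (xs)^{σ(s⁻¹)}.
  FracCayley : ∀ {m k} → (Fin m → A) → (SIdx m → Fin k) → Multigraph
  FracCayley {m} {k} gen σ = record
    { Vertex = A × Fin k
    ; Edge   = A × SIdx m
    ; ends   = λ { (x , s) → ((x , σ s) , (x ∙ sElt gen s , σ (invIdx s))) }
    }

{-# OPTIONS --safe #-}
module Submission where

-- Backwards, colour v^B by the colour of B in B(σ).  Forwards, colour the
-- block B by the parity of the number of x ∈ Γ with x^B on side true.  An
-- edge g ∈ S₀ of B(σ) comes from the edges x^{σ(g)} — (xg)^{σ(g⁻¹)} of the
-- fractured graph, which force f(xg, σ(g⁻¹)) = not f(x, σ(g)); since x ↦ xg
-- permutes Γ, the two parities differ by the parity of |Γ|, which is odd.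

open import Defs
open import Data.Nat using (ℕ; _+_; _*_)
open import Data.Nat.Properties using (+-identityʳ)
open import Data.Fin using (Fin)
open import Data.Fin.Permutation using (Permutation)
open import Data.Bool using (Bool; true; false; not; _xor_)
open import Data.Bool.Properties
  using (xor-∧-commutativeRing; xor-same; ¬-not; not-¬)
open import Data.Vec.Functional using (Vector; replicate)
open import Data.Product using (_,_)
open import Function using (_∘_)
open import Function.Bundles using (_↔_; _⇔_; Inverse; mk↔ₛ′; mk⇔)
open import Function.Construct.Composition using (_↔-∘_)
open import Function.Construct.Symmetry using (↔-sym)
open import Function.Definitions using (Injective)
open import Algebra.Bundles using (CommutativeMonoid; CommutativeRing; Group)
open import Algebra.Structures using (IsGroup)
open import Relation.Binary.PropositionalEquality
  using (_≡_; ≢-sym; refl; trans; cong; module ≡-Reasoning)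
import Algebra.Properties.CommutativeMonoid.Sum as CommutativeMonoidSum
import Algebra.Properties.Group as GroupProperties
import Algebra.Properties.Monoid.Mult as MonoidMult

module FiniteGroup {A : Set} {_∙_ : A → A → A} {ε : A} {_⁻¹ : A → A}
                   (isGroup : IsGroup _≡_ _∙_ ε _⁻¹)
                   {n : ℕ} (enumeration : Fin n ↔ A) where

  group : Group _ _
  group = record { isGroup = isGroup }

  open GroupProperties group using (//-rightDividesˡ; //-rightDividesʳ)
  open Inverse enumeration using (to; from; strictlyInverseˡ)

  rightTranslation : A → A ↔ A
  rightTranslation g =
    mk↔ₛ′ (_∙ g) (_∙ (g ⁻¹)) (//-rightDividesˡ g) (//-rightDividesʳ g)

  rightTranslationPermutation : A → Permutation n n
  rightTranslationPermutation g =
    ↔-sym enumeration ↔-∘ (rightTranslation g ↔-∘ enumeration)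

  module _ {c ℓ} (M : CommutativeMonoid c ℓ) where

    open CommutativeMonoid M using (Carrier; _≈_; setoid)
    open import Relation.Binary.Reasoning.Setoid setoid
    open CommutativeMonoidSum M using (sum; sum-permute; sum-cong-≗)

    ∑ : (A → Carrier) → Carrier
    ∑ f = sum (f ∘ to)

    ∑-rightInvariant : ∀ (f : A → Carrier) g → ∑ f ≈ ∑ (λ x → f (x ∙ g))
    ∑-rightInvariant f g = begin
      ∑ f
        ≈⟨ sum-permute (f ∘ to) (rightTranslationPermutation g) ⟩
      sum (λ i → f (to (from (to i ∙ g))))
        ≡⟨ sum-cong-≗ (λ i → cong f (strictlyInverseˡ (to i ∙ g))) ⟩
      ∑ (λ x → f (x ∙ g))
        ∎

-- Summing Booleans in this monoid counts the entries true modulo 2.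
xor-commutativeMonoid : CommutativeMonoid _ _
xor-commutativeMonoid = CommutativeRing.+-commutativeMonoid xor-∧-commutativeRing

open CommutativeMonoidSum xor-commutativeMonoid using (sum; sum-cong-≗; ∑-distrib-+; sum-replicate)
open MonoidMult (CommutativeMonoid.monoid xor-commutativeMonoid) using (_×_; ×-homo-+)

odd×true≡true : ∀ {n} → Odd n → n × true ≡ true
odd×true≡true (j , refl) = begin
  (1 + 2 * j) × true
    ≡⟨ ×-homo-+ true 1 (2 * j) ⟩
  true xor (2 * j) × true
    ≡⟨ cong (true xor_) (×-homo-+ true j (j + 0)) ⟩
  true xor (j × true xor (j + 0) × true)
    ≡⟨ cong (λ k → true xor (j × true xor k × true)) (+-identityʳ j) ⟩
  true xor (j × true xor j × true)
    ≡⟨ cong (true xor_) (xor-same (j × true)) ⟩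
  true
    ∎
  where open ≡-Reasoning

sum-not : ∀ {n} (f : Vector Bool n) → sum (not ∘ f) ≡ n × true xor sum f
sum-not {n} f = begin
  sum (λ i → true xor f i)               ≡⟨ ∑-distrib-+ (replicate n true) f ⟩
  sum (replicate n true) xor sum f       ≡⟨ cong (_xor sum f) (sum-replicate n) ⟩
  n × true xor sum f                     ∎
  where open ≡-Reasoning

bipartiteB⇒bipartiteFrac : ∀ {A : Set} (_∙_ : A → A → A) (ε : A) (_⁻¹ : A → A)
  {m k} (gen : Fin m → A) (σ : SIdx m → Fin k)
  → Bipartite (BGraph σ) → Bipartite (FracCayley _∙_ ε _⁻¹ gen σ)
bipartiteB⇒bipartiteFrac _ _ _ _ _ (side , proper) =
  (λ (_ , B) → side B) , λ { (_ , (i , true))  → proper i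
                            ; (_ , (i , false)) → ≢-sym (proper i) }

bipartiteFrac⇒bipartiteB : ∀ {A : Set} {_∙_ : A → A → A} {ε : A} {_⁻¹ : A → A}
  → IsGroup _≡_ _∙_ ε _⁻¹ → ∀ {n} → Fin n ↔ A → Odd n
  → ∀ {m k} (gen : Fin m → A) (σ : SIdx m → Fin k)
  → Bipartite (FracCayley _∙_ ε _⁻¹ gen σ) → Bipartite (BGraph σ)
bipartiteFrac⇒bipartiteB {_∙_ = _∙_} isGroup {n} enumeration odd {k = k} gen σ (side , proper) =
  parity , λ i eq → not-¬ refl (trans eq (parity-flips i))
  where
  open FiniteGroup isGroup enumeration using (∑; ∑-rightInvariant)
  open Inverse enumeration using (to)

  parity : Fin k → Bool
  parity B = ∑ xor-commutativeMonoid (λ x → side (x , B))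

  parity-flips : ∀ i → parity (σ (i , false)) ≡ not (parity (σ (i , true)))
  parity-flips i = begin
    parity B′
      ≡⟨ ∑-rightInvariant xor-commutativeMonoid (λ x → side (x , B′)) (gen i) ⟩
    sum (λ t → side (to t ∙ gen i , B′))
      ≡⟨ sum-cong-≗ (λ t → ¬-not (≢-sym (proper (to t , (i , true))))) ⟩
    sum (λ t → not (side (to t , B)))
      ≡⟨ sum-not (λ t → side (to t , B)) ⟩
    n × true xor parity B
      ≡⟨ cong (_xor parity B) (odd×true≡true odd) ⟩
    not (parity B)
      ∎
    where
    open ≡-Reasoning
    B B′ : Fin k
    B  = σ (i , true)
    B′ = σ (i , false)

proposition4p12 : {A : Set} (_∙_ : A → A → A) (ε : A) (_⁻¹ : A → A)
    → IsGroup _≡_ _∙_ ε _⁻¹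
    → (n : ℕ) → (Fin n ↔ A) → Odd n
    → (m : ℕ) (gen : Fin m → A)
    → Generates _∙_ ε _⁻¹ gen
    → Injective _≡_ _≡_ (sElt _∙_ ε _⁻¹ gen)
    → (k : ℕ) (σ : SIdx m → Fin k) → IsPartitionLabelling σ
    → Bipartite (FracCayley _∙_ ε _⁻¹ gen σ) ⇔ Bipartite (BGraph σ)
proposition4p12 _∙_ ε _⁻¹ isGroup _ enumeration odd _ gen _ _ _ σ _ =
  mk⇔ (bipartiteFrac⇒bipartiteB isGroup enumeration odd gen σ)
      (bipartiteB⇒bipartiteFrac _∙_ ε _⁻¹ gen σ)
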